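{- For integers $0\le m\le n-1$ and $1\le k\le 2m$, \[\sum_{h=0}^{n-m}\frac{k}{h+k}\binom{2h+k-1}{h}\binom{2n-2h-k}{n-m-h}=\binom{2n}{n-m}.\] -}

module Defs where

open import Data.Nat using (ℕ; zero; suc)
open import Data.Integer using (+_)
open import Data.Rational using (ℚ; 0ℚ; _/_; _+_)

-- The rational number a / b.  Only used with b ≥ 1; the b = 0 case is a
-- dummy value (never reached under the theorem's hypotheses).
frac : ℕ → ℕ → ℚ
frac a zero    = 0ℚ
frac a (suc b) = (+ a) / suc b

sumTo : ℕ → (ℕ → ℚ) → ℚ
sumTo zero    f = f 0
sumTo (suc N) f = sumTo N f + f (suc N)

{-# OPTIONS --safe #-}
-- Let ballot h k count the ±1 paths that start at height k, take h up-steps and reach height 0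
-- only at their end, and let paths r j = C(2j + r, j) count the paths with j up-steps and j + r
-- down-steps.  By the reflection principle ballot h k = C(2h+k−1, h) − C(2h+k−1, h+k), and
-- absorption turns this into (h + k) · ballot h k = k · C(2h+k−1, h); so the h-th summand is
-- ballot h k · paths (2m − k) (n − m − h).  Cutting a path counted by paths (k + r) N, started at
-- height k + r, at its first visit to height r gives  Σ_h ballot h k · paths r (N − h) = paths (k + r) N,
-- and N = n − m, r = 2m − k turn the right-hand side into C(2n, n − m).  Both identities are proved from the
-- first-step recursion of ballot and Pascal's rule.
module Submission where

module BallotNumbers where

  open import Data.Nat
  open import Data.Nat.Properties
  open import Data.Nat.Combinatorics using (_C_; nCk≡nC[n∸k]; nCk+nC[k+1]≡[n+1]C[k+1]; k>n⇒nCk≡0; nC1≡n)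
  open import Data.Nat.Tactic.RingSolver using (solve-∀)
  open import Relation.Binary.PropositionalEquality
  open import Function using (_∘_)
  open import Algebra.Properties.CommutativeSemigroup +-commutativeSemigroup using (interchange)
  open ≡-Reasoning

  [a+b]Ca≡[a+b]Cb : ∀ a b → (a + b) C a ≡ (a + b) C b
  [a+b]Ca≡[a+b]Cb a b = trans (nCk≡nC[n∸k] (m≤m+n a b)) (cong ((a + b) C_) (m+n∸m≡n a b))

  [k+1]*[n+1]C[k+1]≡[n+1]*nCk : ∀ n k → suc k * (suc n C suc k) ≡ suc n * (n C k)
  [k+1]*[n+1]C[k+1]≡[n+1]*nCk zero    zero    = refl
  [k+1]*[n+1]C[k+1]≡[n+1]*nCk zero    (suc k) =
    trans (cong (suc (suc k) *_) (k>n⇒nCk≡0 {1} {suc (suc k)} (s≤s (s≤s z≤n)))) (*-zeroʳ (suc (suc k)))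
  [k+1]*[n+1]C[k+1]≡[n+1]*nCk (suc n) zero    =
    trans (+-identityʳ _) (trans (nC1≡n (suc (suc n))) (sym (*-identityʳ (suc (suc n)))))
  [k+1]*[n+1]C[k+1]≡[n+1]*nCk (suc n) (suc k) = begin
    suc (suc k) * (suc (suc n) C suc (suc k))
      ≡⟨ cong (suc (suc k) *_) (nCk+nC[k+1]≡[n+1]C[k+1] (suc n) (suc k)) ⟨
    suc (suc k) * (suc n C suc k + suc n C suc (suc k))
      ≡⟨ *-distribˡ-+ (suc (suc k)) (suc n C suc k) _ ⟩
    suc (suc k) * (suc n C suc k) + suc (suc k) * (suc n C suc (suc k))
      ≡⟨ cong₂ (λ x y → suc n C suc k + x + y) (IH k) (IH (suc k)) ⟩
    suc n C suc k + suc n * (n C k) + suc n * (n C suc k)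
      ≡⟨ cong (λ x → x + suc n * (n C k) + suc n * (n C suc k)) (nCk+nC[k+1]≡[n+1]C[k+1] n k) ⟨
    n C k + n C suc k + suc n * (n C k) + suc n * (n C suc k)
      ≡⟨ regroup n (n C k) (n C suc k) ⟩
    suc (suc n) * (n C k + n C suc k)
      ≡⟨ cong (suc (suc n) *_) (nCk+nC[k+1]≡[n+1]C[k+1] n k) ⟩
    suc (suc n) * (suc n C suc k) ∎
    where
    IH : ∀ j → suc j * (suc n C suc j) ≡ suc n * (n C j)
    IH = [k+1]*[n+1]C[k+1]≡[n+1]*nCk n
    regroup : ∀ n x y → x + y + suc n * x + suc n * y ≡ suc (suc n) * (x + y)
    regroup = solve-∀

  a*[a+b]Cb≡[1+b]*[a+b]C[1+b] : ∀ a b → a * ((a + b) C b) ≡ suc b * ((a + b) C suc b)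
  a*[a+b]Cb≡[1+b]*[a+b]C[1+b] zero    b = sym (trans (cong (suc b *_) (k>n⇒nCk≡0 (n<1+n b))) (*-zeroʳ (suc b)))
  a*[a+b]Cb≡[1+b]*[a+b]C[1+b] (suc a) b = begin
    suc a * (suc (a + b) C b)       ≡⟨ cong (suc a *_) ([a+b]Ca≡[a+b]Cb (suc a) b) ⟨
    suc a * (suc (a + b) C suc a)   ≡⟨ [k+1]*[n+1]C[k+1]≡[n+1]*nCk (a + b) a ⟩
    suc (a + b) * ((a + b) C a)     ≡⟨ cong (suc (a + b) *_) ([a+b]Ca≡[a+b]Cb a b) ⟩
    suc (a + b) * ((a + b) C b)     ≡⟨ [k+1]*[n+1]C[k+1]≡[n+1]*nCk (a + b) b ⟨
    suc b * (suc (a + b) C suc b)   ∎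

  [1+h]+[[1+h]+s]≡h+[h+[2+s]] : ∀ h s → suc h + (suc h + s) ≡ h + (h + suc (suc s))
  [1+h]+[[1+h]+s]≡h+[h+[2+s]] = solve-∀

  -- First step from height k + 1: down to height k, or up to height k + 2.
  ballot : ℕ → ℕ → ℕ
  ballot zero    k       = 1
  ballot (suc h) zero    = 0
  ballot (suc h) (suc k) = ballot (suc h) k + ballot h (suc (suc k))

  pascal-difference : ∀ n h j {b₁ b₂} →
                      b₁ + n C suc j ≡ n C suc h →
                      b₂ + n C suc (suc j) ≡ n C h →
                      (b₁ + b₂) + suc n C suc (suc j) ≡ suc n C suc h
  pascal-difference n h j {b₁} {b₂} eq₁ eq₂ = begin
    b₁ + b₂ + suc n C suc (suc j)             ≡⟨ cong (b₁ + b₂ +_) (nCk+nC[k+1]≡[n+1]C[k+1] n (suc j)) ⟨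
    b₁ + b₂ + (n C suc j + n C suc (suc j))   ≡⟨ interchange b₁ b₂ (n C suc j) (n C suc (suc j)) ⟩
    (b₁ + n C suc j) + (b₂ + n C suc (suc j)) ≡⟨ cong₂ _+_ eq₁ eq₂ ⟩
    n C suc h + n C h                         ≡⟨ +-comm (n C suc h) (n C h) ⟩
    n C h + n C suc h                         ≡⟨ nCk+nC[k+1]≡[n+1]C[k+1] n h ⟩
    suc n C suc h                             ∎

  ballot-difference-step : ∀ h s → let n = h + (h + suc s) in
    ballot (suc h) s + n C suc (h + s) ≡ n C suc h →
    ballot h (suc (suc s)) + n C suc (h + suc s) ≡ n C h →
    ballot (suc h) (suc s) + (suc h + (suc h + s)) C suc (suc h + s) ≡ (suc h + (suc h + s)) C suc h
  ballot-difference-step h s eq₁ eq₂ =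
    subst (λ m → ballot (suc h) (suc s) + m C suc (suc (h + s)) ≡ m C suc h) (cong (λ x → suc (h + x)) (+-suc h s))
      (pascal-difference n h (h + s) eq₁ (subst (λ j → ballot h (suc (suc s)) + n C suc j ≡ n C h) (+-suc h s) eq₂))
    where
    n = h + (h + suc s)

  ballot-difference : ∀ h s → ballot h (suc s) + (h + (h + s)) C suc (h + s) ≡ (h + (h + s)) C h
  ballot-difference zero    s       = cong (1 +_) (k>n⇒nCk≡0 (n<1+n s))
  ballot-difference (suc h) zero    =
    ballot-difference-step h 0 (cong (λ j → (h + (h + 1)) C suc j) (+-identityʳ h)) (ballot-difference h 1)
  ballot-difference (suc h) (suc s) =
    ballot-difference-step h (suc s)
      (subst₂ (λ n j → ballot (suc h) (suc s) + n C suc j ≡ n C suc h)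
              ([1+h]+[[1+h]+s]≡h+[h+[2+s]] h s) (sym (+-suc h s)) (ballot-difference (suc h) s))
      (ballot-difference h (suc (suc s)))

  ballot-closed-form : ∀ h s → suc (h + s) * ballot h (suc s) ≡ suc s * ((h + (h + s)) C h)
  ballot-closed-form h s = begin
    suc (h + s) * ballot h (suc s)      ≡⟨ cong (suc (h + s) *_) ballot≡c∸c′ ⟩
    suc (h + s) * (c ∸ c′)              ≡⟨ *-distribˡ-∸ (suc (h + s)) c c′ ⟩
    suc (h + s) * c ∸ suc (h + s) * c′  ≡⟨ cong (suc (h + s) * c ∸_) h*c≡[1+h+s]*c′ ⟨
    suc (h + s) * c ∸ h * c             ≡⟨ *-distribʳ-∸ c (suc (h + s)) h ⟨
    (suc (h + s) ∸ h) * c               ≡⟨ cong (λ x → (x ∸ h) * c) (+-suc h s) ⟨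
    (h + suc s ∸ h) * c                 ≡⟨ cong (_* c) (m+n∸m≡n h (suc s)) ⟩
    suc s * c                           ∎
    where
    c  = (h + (h + s)) C h
    c′ = (h + (h + s)) C suc (h + s)
    ballot≡c∸c′ : ballot h (suc s) ≡ c ∸ c′
    ballot≡c∸c′ = trans (sym (m+n∸n≡m (ballot h (suc s)) c′)) (cong (_∸ c′) (ballot-difference h s))
    h*c≡[1+h+s]*c′ : h * c ≡ suc (h + s) * c′
    h*c≡[1+h+s]*c′ =
      trans (cong (h *_) ([a+b]Ca≡[a+b]Cb h (h + s))) (a*[a+b]Cb≡[1+b]*[a+b]C[1+b] h (h + s))

  paths : ℕ → ℕ → ℕ
  paths r j = (j + (j + r)) C j

  paths-pascal : ∀ r N → paths r (suc N) + paths (suc (suc r)) N ≡ paths (suc r) (suc N)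
  paths-pascal r N = begin
    paths r (suc N) + paths (suc (suc r)) N  ≡⟨ cong (λ n → n C suc N + T C N) ([1+h]+[[1+h]+s]≡h+[h+[2+s]] N r) ⟩
    T C suc N + T C N                        ≡⟨ +-comm (T C suc N) (T C N) ⟩
    T C N + T C suc N                        ≡⟨ nCk+nC[k+1]≡[n+1]C[k+1] T N ⟩
    suc T C suc N                            ≡⟨ cong (λ n → suc (N + n) C suc N) (+-suc N (suc r)) ⟩
    paths (suc r) (suc N)                    ∎
    where
    T = N + (N + suc (suc r))

  convolution : (ℕ → ℕ) → (ℕ → ℕ) → ℕ → ℕ
  convolution f g zero    = f 0 * g 0
  convolution f g (suc N) = f 0 * g (suc N) + convolution (f ∘ suc) g N

  convolution-zeroˡ : ∀ g N → convolution (λ _ → 0) g N ≡ 0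
  convolution-zeroˡ g zero    = refl
  convolution-zeroˡ g (suc N) = convolution-zeroˡ g N

  convolution-distribʳ-+ : ∀ f f′ g N →
    convolution (λ h → f h + f′ h) g N ≡ convolution f g N + convolution f′ g N
  convolution-distribʳ-+ f f′ g zero    = *-distribʳ-+ (g 0) (f 0) (f′ 0)
  convolution-distribʳ-+ f f′ g (suc N) = begin
    (f 0 + f′ 0) * g (suc N) + convolution (λ h → f (suc h) + f′ (suc h)) g N
      ≡⟨ cong₂ _+_ (*-distribʳ-+ (g (suc N)) (f 0) (f′ 0)) (convolution-distribʳ-+ (f ∘ suc) (f′ ∘ suc) g N) ⟩
    (f 0 * g (suc N) + f′ 0 * g (suc N)) + (convolution (f ∘ suc) g N + convolution (f′ ∘ suc) g N)
      ≡⟨ interchange (f 0 * g (suc N)) (f′ 0 * g (suc N)) (convolution (f ∘ suc) g N) (convolution (f′ ∘ suc) g N) ⟩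
    convolution f g (suc N) + convolution f′ g (suc N) ∎

  ballot-convolution : ∀ N k r → convolution (λ h → ballot h k) (paths r) N ≡ paths (k + r) N
  ballot-convolution zero    k       r = refl
  ballot-convolution (suc N) zero    r =
    trans (cong (1 * paths r (suc N) +_) (convolution-zeroˡ (paths r) N)) (trans (+-identityʳ _) (*-identityˡ _))
  ballot-convolution (suc N) (suc k) r = begin
    1 * paths r (suc N) + conv (λ h → ballot (suc h) k + ballot h (suc (suc k))) N
      ≡⟨ cong (1 * paths r (suc N) +_)
              (convolution-distribʳ-+ (λ h → ballot (suc h) k) (λ h → ballot h (suc (suc k))) (paths r) N) ⟩
    1 * paths r (suc N) + (conv (λ h → ballot (suc h) k) N + conv (λ h → ballot h (suc (suc k))) N)
      ≡⟨ +-assoc (1 * paths r (suc N)) _ _ ⟨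
    conv (λ h → ballot h k) (suc N) + conv (λ h → ballot h (suc (suc k))) N
      ≡⟨ cong₂ _+_ (ballot-convolution (suc N) k r) (ballot-convolution N (suc (suc k)) r) ⟩
    paths (k + r) (suc N) + paths (suc (suc k) + r) N
      ≡⟨ paths-pascal (k + r) N ⟩
    paths (suc k + r) (suc N) ∎
    where
    conv : (ℕ → ℕ) → ℕ → ℕ
    conv f = convolution f (paths r)

open import Defs
open import Data.Nat using (ℕ; zero; suc; z≤n; s≤s; _≤_; _<_; _∸_)
open import Data.Nat.Combinatorics using (_C_)
open import Data.Nat as N using ()
open import Data.Integer using (+_)
open import Data.Rational using (ℚ; _+_; _*_; _/_; toℚᵘ)
open import Relation.Binary.PropositionalEquality using (_≡_; refl; sym; trans; cong; cong₂; module ≡-Reasoning)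
import Data.Nat.Properties as ℕ
open import Data.Nat.Tactic.RingSolver using (solve-∀)
open import Data.Integer.Tactic.RingSolver using () renaming (solve-∀ to ℤ-solve-∀)
import Data.Integer as ℤ
import Data.Integer.Properties as ℤ
open import Data.Rational.Properties using (toℚᵘ-injective; toℚᵘ-fromℚᵘ; toℚᵘ-homo-+; toℚᵘ-homo-*)
import Data.Rational.Properties as ℚ
import Data.Rational.Unnormalised as ℚᵘ
open import Data.Rational.Unnormalised using (mkℚᵘ; *≡*)
import Data.Rational.Unnormalised.Properties as ℚᵘ
open import Function using (_∘_)
open BallotNumbers using (ballot; ballot-closed-form; paths; convolution; ballot-convolution)

ι : ℕ → ℚ
ι n = + n / 1

ι-homo-+ : ∀ a b → ι (a N.+ b) ≡ ι a + ι b
ι-homo-+ a b = toℚᵘ-injective (begin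
  toℚᵘ (ι (a N.+ b))               ≈⟨ toℚᵘ-fromℚᵘ (mkℚᵘ (+ (a N.+ b)) 0) ⟩
  mkℚᵘ (+ (a N.+ b)) 0             ≈⟨ *≡* (trans (cong (ℤ._* + 1) (ℤ.pos-+ a b)) (regroup (+ a) (+ b))) ⟩
  mkℚᵘ (+ a) 0 ℚᵘ.+ mkℚᵘ (+ b) 0   ≈⟨ ℚᵘ.+-cong (toℚᵘ-fromℚᵘ (mkℚᵘ (+ a) 0)) (toℚᵘ-fromℚᵘ (mkℚᵘ (+ b) 0)) ⟨
  toℚᵘ (ι a) ℚᵘ.+ toℚᵘ (ι b)       ≈⟨ toℚᵘ-homo-+ (ι a) (ι b) ⟨
  toℚᵘ (ι a + ι b)                 ∎)
  where
  open ℚᵘ.≃-Reasoning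
  regroup : ∀ x y → (x ℤ.+ y) ℤ.* + 1 ≡ (x ℤ.* + 1 ℤ.+ y ℤ.* + 1) ℤ.* + 1
  regroup = ℤ-solve-∀

frac*ι≡ι : ∀ k d c x → suc d N.* x ≡ k N.* c → frac k (suc d) * ι c ≡ ι x
frac*ι≡ι k d c x [1+d]x≡kc = toℚᵘ-injective (begin
  toℚᵘ (frac k (suc d) * ι c)            ≈⟨ toℚᵘ-homo-* (frac k (suc d)) (ι c) ⟩
  toℚᵘ (frac k (suc d)) ℚᵘ.* toℚᵘ (ι c)  ≈⟨ ℚᵘ.*-cong (toℚᵘ-fromℚᵘ (mkℚᵘ (+ k) d)) (toℚᵘ-fromℚᵘ (mkℚᵘ (+ c) 0)) ⟩
  mkℚᵘ (+ k) d ℚᵘ.* mkℚᵘ (+ c) 0         ≈⟨ *≡* cross ⟩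
  mkℚᵘ (+ x) 0                           ≈⟨ toℚᵘ-fromℚᵘ (mkℚᵘ (+ x) 0) ⟨
  toℚᵘ (ι x)                             ∎)
  where
  open ℚᵘ.≃-Reasoning
  kc≡x[[1+d]*1] : k N.* c ≡ x N.* (suc d N.* 1)
  kc≡x[[1+d]*1] =
    trans (sym [1+d]x≡kc) (trans (ℕ.*-comm (suc d) x) (cong (x N.*_) (sym (ℕ.*-identityʳ (suc d)))))
  cross : (+ k ℤ.* + c) ℤ.* + 1 ≡ + x ℤ.* + (suc d N.* 1)
  cross = trans (ℤ.*-identityʳ (+ k ℤ.* + c))
                (trans (sym (ℤ.pos-* k c)) (trans (cong +_ kc≡x[[1+d]*1]) (ℤ.pos-* x (suc d N.* 1))))

ι-homo-* : ∀ a b → ι (a N.* b) ≡ ι a * ι b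
ι-homo-* a b = sym (frac*ι≡ι a 0 b (a N.* b) (ℕ.+-identityʳ (a N.* b)))

sumTo-cong : ∀ N {f g} → (∀ h → h ≤ N → f h ≡ g h) → sumTo N f ≡ sumTo N g
sumTo-cong zero    f≗g = f≗g 0 z≤n
sumTo-cong (suc N) f≗g =
  cong₂ _+_ (sumTo-cong N (λ h h≤N → f≗g h (ℕ.m≤n⇒m≤1+n h≤N))) (f≗g (suc N) ℕ.≤-refl)

sumTo-suc : ∀ N f → sumTo (suc N) f ≡ f 0 + sumTo N (f ∘ suc)
sumTo-suc zero    f = refl
sumTo-suc (suc N) f = trans (cong (_+ f (suc (suc N))) (sumTo-suc N f)) (ℚ.+-assoc (f 0) _ _)

sumTo-convolution : ∀ N f g → sumTo N (λ h → ι (f h N.* g (N ∸ h))) ≡ ι (convolution f g N)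
sumTo-convolution zero    f g = refl
sumTo-convolution (suc N) f g = begin
  sumTo (suc N) (λ h → ι (f h N.* g (suc N ∸ h)))           ≡⟨ sumTo-suc N _ ⟩
  ι (f 0 N.* g (suc N)) + sumTo N (λ h → ι (f (suc h) N.* g (N ∸ h)))
    ≡⟨ cong (λ q → ι (f 0 N.* g (suc N)) + q) (sumTo-convolution N (f ∘ suc) g) ⟩
  ι (f 0 N.* g (suc N)) + ι (convolution (f ∘ suc) g N)    ≡⟨ ι-homo-+ (f 0 N.* g (suc N)) _ ⟨
  ι (convolution f g (suc N))                               ∎
  where open ≡-Reasoning

frac*C≡ballot : ∀ h s → frac (suc s) (h N.+ suc s) * ι ((2 N.* h N.+ suc s ∸ 1) C h) ≡ ι (ballot h (suc s))
frac*C≡ballot h s = begin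
  frac (suc s) (h N.+ suc s) * ι ((2 N.* h N.+ suc s ∸ 1) C h)
    ≡⟨ cong₂ (λ d n → frac (suc s) d * ι (n C h)) (ℕ.+-suc h s) (cong (_∸ 1) (row h s)) ⟩
  frac (suc s) (suc (h N.+ s)) * ι ((h N.+ (h N.+ s)) C h)
    ≡⟨ frac*ι≡ι (suc s) (h N.+ s) _ _ (ballot-closed-form h s) ⟩
  ι (ballot h (suc s))
    ∎
  where
  open ≡-Reasoning
  row : ∀ h s → 2 N.* h N.+ suc s ≡ suc (h N.+ (h N.+ s))
  row = solve-∀

2n≡N+[N+[k+r]] : ∀ m N k r {n} → m N.+ N ≡ n → k N.+ r ≡ 2 N.* m → 2 N.* n ≡ N N.+ (N N.+ (k N.+ r))
2n≡N+[N+[k+r]] m N k r refl k+r≡2m =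
  trans (rearrange m N) (cong (λ t → N N.+ (N N.+ t)) (sym k+r≡2m))
  where
  rearrange : ∀ m N → 2 N.* (m N.+ N) ≡ N N.+ (N N.+ 2 N.* m)
  rearrange = solve-∀

t∸2h∸k≡[N∸h]+[[N∸h]+r] : ∀ {t h N} k r → h ≤ N → t ≡ N N.+ (N N.+ (k N.+ r)) →
                         t ∸ 2 N.* h ∸ k ≡ (N ∸ h) N.+ ((N ∸ h) N.+ r)
t∸2h∸k≡[N∸h]+[[N∸h]+r] {t} {h} {N} k r h≤N t≡ = begin
  t ∸ 2 N.* h ∸ k                                            ≡⟨ ℕ.∸-+-assoc t (2 N.* h) k ⟩
  t ∸ (2 N.* h N.+ k)                                        ≡⟨ cong (_∸ (2 N.* h N.+ k)) t≡ ⟩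
  N N.+ (N N.+ (k N.+ r)) ∸ (2 N.* h N.+ k)
    ≡⟨ cong (λ M → M N.+ (M N.+ (k N.+ r)) ∸ (2 N.* h N.+ k)) (ℕ.m+[n∸m]≡n h≤N) ⟨
  (h N.+ d) N.+ ((h N.+ d) N.+ (k N.+ r)) ∸ (2 N.* h N.+ k)  ≡⟨ cong (_∸ (2 N.* h N.+ k)) (rearrange h d k r) ⟩
  (2 N.* h N.+ k) N.+ (d N.+ (d N.+ r)) ∸ (2 N.* h N.+ k)    ≡⟨ ℕ.m+n∸m≡n (2 N.* h N.+ k) (d N.+ (d N.+ r)) ⟩
  d N.+ (d N.+ r)                                            ∎
  where
  open ≡-Reasoning
  d = N ∸ h
  rearrange : ∀ h d k r → (h N.+ d) N.+ ((h N.+ d) N.+ (k N.+ r)) ≡ (2 N.* h N.+ k) N.+ (d N.+ (d N.+ r))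
  rearrange = solve-∀

corollary4p4 : (m n k : ℕ) → m < n → 1 ≤ k → k ≤ 2 N.* m →
    sumTo (n ∸ m) (λ h → frac k (h N.+ k) * (+ ((2 N.* h N.+ k ∸ 1) C h) / 1) * (+ ((2 N.* n ∸ 2 N.* h ∸ k) C (n ∸ m ∸ h)) / 1))
      ≡ + ((2 N.* n) C (n ∸ m)) / 1
corollary4p4 m n k@(suc s) m<n (s≤s z≤n) k≤2m = begin
  sumTo N summand                                     ≡⟨ sumTo-cong N summand≡ ⟩
  sumTo N (λ h → ι (ballot h k N.* paths r (N ∸ h)))  ≡⟨ sumTo-convolution N (λ h → ballot h k) (paths r) ⟩
  ι (convolution (λ h → ballot h k) (paths r) N)      ≡⟨ cong ι (ballot-convolution N k r) ⟩
  ι (paths (k N.+ r) N)                               ≡⟨ cong (λ t → ι (t C N)) 2n≡ ⟨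
  ι ((2 N.* n) C N)                                   ∎
  where
  open ≡-Reasoning
  N = n ∸ m
  r = 2 N.* m ∸ k
  summand : ℕ → ℚ
  summand h = frac k (h N.+ k) * ι ((2 N.* h N.+ k ∸ 1) C h) * ι ((2 N.* n ∸ 2 N.* h ∸ k) C (N ∸ h))
  2n≡ : 2 N.* n ≡ N N.+ (N N.+ (k N.+ r))
  2n≡ = 2n≡N+[N+[k+r]] m N k r (ℕ.m+[n∸m]≡n (ℕ.<⇒≤ m<n)) (ℕ.m+[n∸m]≡n k≤2m)
  summand≡ : ∀ h → h ≤ N → summand h ≡ ι (ballot h k N.* paths r (N ∸ h))
  summand≡ h h≤N = begin
    summand h
      ≡⟨ cong₂ (λ b t → b * ι (t C (N ∸ h))) (frac*C≡ballot h s) (t∸2h∸k≡[N∸h]+[[N∸h]+r] k r h≤N 2n≡) ⟩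
    ι (ballot h k) * ι (paths r (N ∸ h))  ≡⟨ ι-homo-* (ballot h k) (paths r (N ∸ h)) ⟨
    ι (ballot h k N.* paths r (N ∸ h))    ∎
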